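{- Let $T$ be a ranked monad on $\mathbf{Set}$. Every open $w\in\mathcal O(\mathrm{LB}_1T)$ can be expressed as $w=\bigvee_{m\in T1}\hat m\wedge\mathrm{const}_{w(m)}$, where $\hat m:=\lambda n.\bigvee\{b\in B\mid m\sim_bn\}$ and $\mathrm{const}_u$ is the constant function at $u$. Consequently the frame $\mathcal O(\mathrm{LB}_1T)$ is generated by the opens $[m\,|\,b]:=\lambda n.\llbracket m\sim n\rrbracket\wedge[b]$ for $m\in T1$ and $b\in T2$.
   Context: A monad $T$ on $\mathbf{Set}$: sets $TA$, $\mathrm{return}\,a$, binds $t\mathbin{>\!\!>\!=}u$ with the monad laws; $t\mathbin{>\!\!>}s:=t\mathbin{>\!\!>\!=}\lambda\_.s$; ranked of rank $\kappa$. $1=\{*\}$, $2=\{0,1\}$. Behaviour locale $\mathrm{LB}_0T$: frame presented by generators $[b]$ ($b\in T2$), writing $[t\mapsto a]:=[t\mathbin{>\!\!>\!=}\lambda a'.\mathrm{return}\,\delta_a(a')]$, subject to $[t\mapsto a]\wedge[t\mapsto a']=\bot$ ($a\ne a'$), $[t\mathbin{>\!\!>}\mathrm{return}\,a\mapsto a]=\top$, $[t\mathbin{>\!\!>\!=}u\mapsto b]=\bigvee_a[t\mapsto a]\wedge[t\mathbin{>\!\!>}u(a)\mapsto b]$. $B$ is the Boolean algebra of complemented opens of $\mathrm{LB}_0T$. Trace equivalence: $\llbracket m\sim_1m'\rrbracket=\bigvee\{[t\mapsto a]\mid|A|\le\kappa,t\in TA,u,u'\colon A\to T1,a\in A,u(a)=u'(a),m=t\mathbin{>\!\!>\!=}u,m'=t\mathbin{>\!\!>\!=}u'\}$,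 $\llbracket m\sim m'\rrbracket=\bigvee_{k\ge1}\bigvee\{\bigwedge_{i=1}^{k-1}\llbracket m_i\sim_1m_{i+1}\rrbracket\mid m_1=m,\dots,m_k=m'\}$, and $m\sim_bm'$ iff $b\le\llbracket m\sim m'\rrbracket$. Locale of transitions $\mathrm{LB}_1T$: its frame $\mathcal O(\mathrm{LB}_1T)$ is the pointwise-ordered set of functions $w\colon T1\to\mathcal O(\mathrm{LB}_0T)$ such that $m_1\sim_bm_2$ implies $b\wedge w(m_1)=b\wedge w(m_2)$ for all $m_1,m_2\in T1$, $b\in B$. -}

module Defs where

open import Level using (Level; _⊔_; Lift; lift; lower; Setω) renaming (suc to lsuc; zero to lzero)
open import Data.Bool using (Bool; true; false)
open import Data.Unit using (⊤; tt)
open import Data.Empty using (⊥; ⊥-elim)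
open import Data.Nat using (ℕ; zero; suc)
open import Data.Fin using (Fin; zero; suc; fromℕ; inject₁)
open import Data.Product using (Σ; _×_; _,_; proj₁; proj₂)
open import Relation.Nullary using (Dec; yes; no; ¬_)
open import Relation.Binary.PropositionalEquality using (_≡_; _≢_)
open import Function using (_∘_)

record Monad : Set₁ where
  infixl 1 _>>=_ _>>_
  field
    T        : Set → Set
    return   : ∀ {A} → A → T A
    _>>=_    : ∀ {A B} → T A → (A → T B) → T B
    left-id  : ∀ {A B} (a : A) (f : A → T B) → (return a >>= f) ≡ f a
    right-id : ∀ {A} (t : T A) → (t >>= return) ≡ t
    assoc    : ∀ {A B C} (t : T A) (f : A → T B) (g : B → T C) →
               ((t >>= f) >>= g) ≡ (t >>= λ a → f a >>= g)

  _>>_ : ∀ {A B} → T A → T B → T B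
  t >> s = t >>= λ _ → s

  fmap : ∀ {A B} → (A → B) → T A → T B
  fmap f t = t >>= λ a → return (f a)

-- Cardinal comparison against a fixed set K representing the cardinal κ

_↪_ : Set → Set → Set
A ↪ B = Σ (A → B) λ f → ∀ x y → f x ≡ f y → x ≡ y

_≤κ_ : Set → Set → Set
A ≤κ K = A ↪ K

_<κ_ : Set → Set → Set
A <κ K = (A ↪ K) × ¬ (K ↪ A)

IsRanked : Monad → Set → Set₁
IsRanked M K = ∀ {A : Set} (t : T A) →
  Σ Set λ A' → (A' <κ K) × Σ (A' ↪ A) λ i → Σ (T A') λ t' → fmap (proj₁ i) t' ≡ t
  where open Monad M

record Frame (c ℓ : Level) : Set (lsuc (lsuc lzero ⊔ c ⊔ ℓ)) where
  infix 4 _≤_ _≈_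
  infixr 7 _∧_
  field
    Carrier  : Set c
    _≤_      : Carrier → Carrier → Set ℓ
    ≤-refl   : ∀ {x} → x ≤ x
    ≤-trans  : ∀ {x y z} → x ≤ y → y ≤ z → x ≤ z
    _∧_      : Carrier → Carrier → Carrier
    ∧-lb₁    : ∀ x y → x ∧ y ≤ x
    ∧-lb₂    : ∀ x y → x ∧ y ≤ y
    ∧-glb    : ∀ {x y z} → z ≤ x → z ≤ y → z ≤ x ∧ y
    top      : Carrier
    top-max  : ∀ x → x ≤ top
    ⋁        : {I : Set₁} → (I → Carrier) → Carrier
    ⋁-ub     : ∀ {I : Set₁} (f : I → Carrier) (i : I) → f i ≤ ⋁ f
    ⋁-lub    : ∀ {I : Set₁} (f : I → Carrier) {x} → (∀ i → f i ≤ x) → ⋁ f ≤ x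
    distrib  : ∀ x {I : Set₁} (f : I → Carrier) → x ∧ ⋁ f ≤ ⋁ (λ i → x ∧ f i)

  _≈_ : Carrier → Carrier → Set ℓ
  x ≈ y = (x ≤ y) × (y ≤ x)

  bot : Carrier
  bot = ⋁ {I = Lift (lsuc lzero) ⊥} (λ i → ⊥-elim (lower i))

  _∨_ : Carrier → Carrier → Carrier
  x ∨ y = ⋁ {I = Lift (lsuc lzero) Bool} λ { (lift true) → x ; (lift false) → y }

  ⋀ : (n : ℕ) → (Fin n → Carrier) → Carrier
  ⋀ zero    f = top
  ⋀ (suc n) f = f zero ∧ ⋀ n (f ∘ suc)

  IsComplemented : Carrier → Set (c ⊔ ℓ)
  IsComplemented b = Σ Carrier λ b' → (b ∧ b' ≈ bot) × (b ∨ b' ≈ top)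

record IsFrameHom {c ℓ c' ℓ'} (L : Frame c ℓ) (N : Frame c' ℓ')
                  (f : Frame.Carrier L → Frame.Carrier N) : Set (lsuc (lsuc lzero) ⊔ c ⊔ ℓ ⊔ c' ⊔ ℓ') where
  private
    module L = Frame L
    module N = Frame N
  field
    mono     : ∀ {x y} → x L.≤ y → f x N.≤ f y
    pres-∧   : ∀ x y → f (x L.∧ y) N.≈ (f x N.∧ f y)
    pres-top : f L.top N.≈ N.top
    pres-⋁   : ∀ {I : Set₁} (h : I → L.Carrier) → f (L.⋁ h) N.≈ N.⋁ (f ∘ h)

-- The behaviour locale LB₀T, as the frame presented by generators and
-- relations (characterised by its universal property).  Classical logic
-- (as in the paper) is supplied by `lem`, needed to define δ_a.

module Behaviour (M : Monad) (lem : (P : Set) → Dec P) where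
  open Monad M

  δ : ∀ {A : Set} → A → A → Bool
  δ a a' with lem (a ≡ a')
  ... | yes _ = true
  ... | no  _ = false

  _↦_ : ∀ {A : Set} → T A → A → T Bool
  t ↦ a = t >>= λ a' → return (δ a a')

  Respects : ∀ {c ℓ} (N : Frame c ℓ) → (T Bool → Frame.Carrier N) → Set (lsuc lzero ⊔ ℓ)
  Respects N h =
      (∀ {A : Set} (t : T A) (a a' : A) → a ≢ a' → h (t ↦ a) ∧ h (t ↦ a') ≈ bot)
    × (∀ {A C : Set} (t : T A) (c : C) → h ((t >> return c) ↦ c) ≈ top)
    × (∀ {A C : Set} (t : T A) (u : A → T C) (b : C) →
         h ((t >>= u) ↦ b) ≈ ⋁ {I = Lift (lsuc lzero) A} (λ a → h (t ↦ lower a) ∧ h ((t >> u (lower a)) ↦ b)))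
    where open Frame N

  record IsPresentation {c ℓ} (L : Frame c ℓ) (g : T Bool → Frame.Carrier L) : Setω where
    field
      respects  : Respects L g
      existence : ∀ {c' ℓ'} (N : Frame c' ℓ') (h : T Bool → Frame.Carrier N) → Respects N h →
                  Σ (Frame.Carrier L → Frame.Carrier N) λ f →
                    IsFrameHom L N f × (∀ b → Frame._≈_ N (f (g b)) (h b))
      unique    : ∀ {c' ℓ'} (N : Frame c' ℓ') (f f' : Frame.Carrier L → Frame.Carrier N) →
                  IsFrameHom L N f → IsFrameHom L N f' →
                  (∀ b → Frame._≈_ N (f (g b)) (f' (g b))) →
                  ∀ x → Frame._≈_ N (f x) (f' x)

  module Traces (K : Set) (L : Frame (lsuc lzero) (lsuc lzero)) (g : T Bool → Frame.Carrier L) where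
    open Frame L

    Sim1Index : T ⊤ → T ⊤ → Set₁
    Sim1Index m m' =
      Σ Set λ A → (A ≤κ K) × Σ (T A) λ t → Σ (A → T ⊤) λ u → Σ (A → T ⊤) λ u' →
        Σ A λ a → (u a ≡ u' a) × (m ≡ (t >>= u)) × (m' ≡ (t >>= u'))

    ⟦_∼₁_⟧ : T ⊤ → T ⊤ → Carrier
    ⟦ m ∼₁ m' ⟧ = ⋁ {I = Sim1Index m m'} (λ { (A , _ , t , _ , _ , a , _) → g (t ↦ a) })

    -- chains m = m_1, …, m_k = m' (k = n + 1 ≥ 1)
    ChainIndex : T ⊤ → T ⊤ → Set
    ChainIndex m m' = Σ ℕ λ n → Σ (Fin (suc n) → T ⊤) λ ms →
      (ms zero ≡ m) × (ms (fromℕ n) ≡ m')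

    ⟦_∼_⟧ : T ⊤ → T ⊤ → Carrier
    ⟦ m ∼ m' ⟧ = ⋁ {I = Lift (lsuc lzero) (ChainIndex m m')}
      (λ { (lift (n , ms , _)) → ⋀ n (λ i → ⟦ ms (inject₁ i) ∼₁ ms (suc i) ⟧) })

    _∼[_]_ : T ⊤ → Carrier → T ⊤ → Set₁
    m ∼[ b ] m' = b ≤ ⟦ m ∼ m' ⟧

    IsLB1 : (T ⊤ → Carrier) → Set₁
    IsLB1 w = ∀ (m₁ m₂ : T ⊤) (b : Carrier) → IsComplemented b → m₁ ∼[ b ] m₂ →
              (b ∧ w m₁) ≈ (b ∧ w m₂)

    hat : T ⊤ → T ⊤ → Carrier
    hat m n = ⋁ {I = Σ Carrier λ b → IsComplemented b × m ∼[ b ] n} proj₁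

    const : Carrier → T ⊤ → Carrier
    const u _ = u

    [_∣_] : T ⊤ → T Bool → T ⊤ → Carrier
    [ m ∣ b ] n = ⟦ m ∼ n ⟧ ∧ g b

    _∧̇_ : (T ⊤ → Carrier) → (T ⊤ → Carrier) → T ⊤ → Carrier
    (v ∧̇ v') n = v n ∧ v' n

    ⋁̇ : {I : Set₁} → (I → T ⊤ → Carrier) → T ⊤ → Carrier
    ⋁̇ f n = ⋁ (λ i → f i n)

    _≤̇_ : (T ⊤ → Carrier) → (T ⊤ → Carrier) → Set₁
    v ≤̇ v' = ∀ n → v n ≤ v' n

    _≈̇_ : (T ⊤ → Carrier) → (T ⊤ → Carrier) → Set₁
    v ≈̇ v' = ∀ n → v n ≈ v' n

    IsSubframeContainingGens : ((T ⊤ → Carrier) → Set₂) → Set₂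
    IsSubframeContainingGens S =
        (∀ v v' → v ≈̇ v' → S v → S v')
      × (∀ m b → S [ m ∣ b ])
      × S (const top)
      × (∀ v v' → S v → S v' → S (v ∧̇ v'))
      × (∀ (I : Set₁) (f : I → T ⊤ → Carrier) → (∀ i → S (f i)) → S (⋁̇ f))

-- Every open w of LB₁T is determined by its values along the trace-equivalence
-- classes: if m ∼_b n with b complemented then b ∧ w m ≤ w n, so w n is the join
-- of m̂ n ∧ w m over all m, the term m = n supplying all of w n because n̂ n = ⊤.
-- Since ⟦m ∼ n⟧ is built from the generators [t ↦ a], which are complemented
-- in LB₀T, we get m̂ n = ⟦m ∼ n⟧.  Hence m̂ ∧ const_u = [m | b] when u = [b]; the
-- u for which m̂ ∧ const_u lies in a given subframe form a subframe of LB₀T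
-- containing all generators, which is therefore all of LB₀T by the universal
-- property of the presentation.
module Submission where

open import Defs
import Level
open import Level using (_⊔_; Lift; lift; lower) renaming (suc to lsuc; zero to lzero)
open import Data.Bool using (Bool; true; false)
open import Data.Unit using (⊤; tt)
open import Data.Empty using (⊥)
open import Data.Nat using (zero; suc)
open import Data.Fin using (Fin; zero; suc; fromℕ; inject₁)
open import Data.Vec.Functional using (Vector; _∷_; [])
open import Data.Product using (Σ; _×_; _,_; proj₁; proj₂; swap)
open import Relation.Nullary using (Dec; yes; no)
open import Relation.Binary.PropositionalEquality using (_≡_; _≢_; refl; sym)
open import Function using (_∘_; id)

module FrameProperties {c ℓ} (L : Frame c ℓ) where
  open Frame L

  ≈-sym : ∀ {x y} → x ≈ y → y ≈ x
  ≈-sym = swap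

  ∧-mono : ∀ {x y u v} → x ≤ y → u ≤ v → x ∧ u ≤ y ∧ v
  ∧-mono p q = ∧-glb (≤-trans (∧-lb₁ _ _) p) (≤-trans (∧-lb₂ _ _) q)

  ∧-congˡ : ∀ {x u v} → u ≈ v → x ∧ u ≈ x ∧ v
  ∧-congˡ (p , q) = ∧-mono ≤-refl p , ∧-mono ≤-refl q

  ∧-congʳ : ∀ {x y u} → x ≈ y → x ∧ u ≈ y ∧ u
  ∧-congʳ (p , q) = ∧-mono p ≤-refl , ∧-mono q ≤-refl

  ∧-comm : ∀ x y → x ∧ y ≤ y ∧ x
  ∧-comm x y = ∧-glb (∧-lb₂ x y) (∧-lb₁ x y)

  ∧-assoc : ∀ x y z → (x ∧ y) ∧ z ≤ x ∧ (y ∧ z)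
  ∧-assoc x y z = ∧-glb (≤-trans (∧-lb₁ _ _) (∧-lb₁ _ _)) (∧-mono (∧-lb₂ _ _) ≤-refl)

  ∧-distribˡ-∧ : ∀ x y z → x ∧ (y ∧ z) ≈ (x ∧ y) ∧ (x ∧ z)
  ∧-distribˡ-∧ x y z =
      ∧-glb (∧-mono ≤-refl (∧-lb₁ _ _)) (∧-mono ≤-refl (∧-lb₂ _ _))
    , ∧-glb (≤-trans (∧-lb₁ _ _) (∧-lb₁ _ _)) (∧-mono (∧-lb₂ _ _) (∧-lb₂ _ _))

  ⋁-mono : ∀ {I : Set₁} {f h : I → Carrier} → (∀ i → f i ≤ h i) → ⋁ f ≤ ⋁ h
  ⋁-mono f≤h = ⋁-lub _ λ i → ≤-trans (f≤h i) (⋁-ub _ i)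

  ∧-distribˡ-⋁ : ∀ x {I : Set₁} (f : I → Carrier) → x ∧ ⋁ f ≈ ⋁ (λ i → x ∧ f i)
  ∧-distribˡ-⋁ x f = distrib x f , ⋁-lub _ λ i → ∧-mono ≤-refl (⋁-ub f i)

  distribʳ : ∀ {I : Set₁} (f : I → Carrier) y → ⋁ f ∧ y ≤ ⋁ (λ i → f i ∧ y)
  distribʳ f y =
    ≤-trans (∧-comm _ _) (≤-trans (distrib y f) (⋁-mono λ i → ∧-comm y (f i)))

  ⋁-empty : (f : Lift (lsuc lzero) ⊥ → Carrier) → ∀ x → ⋁ f ≤ x
  ⋁-empty f x = ⋁-lub f λ ()

  x≤x∨y : ∀ x y → x ≤ x ∨ y
  x≤x∨y x y = ⋁-ub _ (lift true)

  y≤x∨y : ∀ x y → y ≤ x ∨ y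
  y≤x∨y x y = ⋁-ub _ (lift false)

  ∨-lub : ∀ {x y z} → x ≤ z → y ≤ z → x ∨ y ≤ z
  ∨-lub p q = ⋁-lub _ λ { (lift true) → p ; (lift false) → q }

  ∧-distribˡ-∨ : ∀ x y z → x ∧ (y ∨ z) ≤ (x ∧ y) ∨ (x ∧ z)
  ∧-distribˡ-∨ x y z =
    ≤-trans (distrib _ _) (⋁-lub _ λ { (lift true) → x≤x∨y _ _ ; (lift false) → y≤x∨y _ _ })

  complemented : ∀ {b} b′ → b ∧ b′ ≤ bot → top ≤ b ∨ b′ → IsComplemented b
  complemented b′ disjoint cover = b′ , (disjoint , ⋁-empty _ _) , (top-max _ , cover)

  top-complemented : IsComplemented top
  top-complemented = complemented bot (∧-lb₂ _ _) (x≤x∨y _ _)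

  ∧-complemented : ∀ {b₁ b₂} → IsComplemented b₁ → IsComplemented b₂ → IsComplemented (b₁ ∧ b₂)
  ∧-complemented {b₁} {b₂} (b₁′ , (disjoint₁ , _) , (_ , cover₁)) (b₂′ , (disjoint₂ , _) , (_ , cover₂)) =
    complemented (b₁′ ∨ b₂′) disjoint cover
    where
    disjoint : (b₁ ∧ b₂) ∧ (b₁′ ∨ b₂′) ≤ bot
    disjoint = ≤-trans (∧-distribˡ-∨ _ _ _)
      (∨-lub (≤-trans (∧-mono (∧-lb₁ _ _) ≤-refl) disjoint₁)
             (≤-trans (∧-mono (∧-lb₂ _ _) ≤-refl) disjoint₂))
    b₁-covered : b₁ ≤ (b₁ ∧ b₂) ∨ (b₁′ ∨ b₂′)
    b₁-covered = ≤-trans (∧-glb ≤-refl (≤-trans (top-max _) cover₂))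
      (≤-trans (∧-distribˡ-∨ _ _ _)
        (∨-lub (x≤x∨y _ _) (≤-trans (∧-lb₂ _ _) (≤-trans (y≤x∨y _ _) (y≤x∨y _ _)))))
    cover : top ≤ (b₁ ∧ b₂) ∨ (b₁′ ∨ b₂′)
    cover = ≤-trans cover₁ (∨-lub b₁-covered (≤-trans (x≤x∨y _ _) (y≤x∨y _ _)))

  record IsSubframe {q} (Q : Carrier → Set q) : Set (lsuc (lsuc lzero) ⊔ c ⊔ ℓ ⊔ q) where
    field
      ≈-closed   : ∀ {x y} → x ≈ y → Q x → Q y
      top-closed : Q top
      ∧-closed   : ∀ {x y} → Q x → Q y → Q (x ∧ y)
      ⋁-closed   : ∀ {I : Set₁} (f : I → Carrier) → (∀ i → Q (f i)) → Q (⋁ f)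

  subframe : ∀ {q} {Q : Carrier → Set q} → IsSubframe Q → Frame (c ⊔ q) ℓ
  subframe {Q = Q} Q-sub = record
    { Carrier = Σ Carrier Q
    ; _≤_     = λ x y → proj₁ x ≤ proj₁ y
    ; ≤-refl  = ≤-refl
    ; ≤-trans = ≤-trans
    ; _∧_     = λ x y → proj₁ x ∧ proj₁ y , ∧-closed (proj₂ x) (proj₂ y)
    ; ∧-lb₁   = λ x y → ∧-lb₁ _ _
    ; ∧-lb₂   = λ x y → ∧-lb₂ _ _
    ; ∧-glb   = ∧-glb
    ; top     = top , top-closed
    ; top-max = λ x → top-max _
    ; ⋁       = λ f → ⋁ (proj₁ ∘ f) , ⋁-closed _ (proj₂ ∘ f)
    ; ⋁-ub    = λ f i → ⋁-ub _ i
    ; ⋁-lub   = λ f → ⋁-lub _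
    ; distrib = λ x f → distrib _ _
    }
    where open IsSubframe Q-sub


module ComplementedPart (L : Frame (lsuc lzero) (lsuc lzero)) where
  open Frame L
  open FrameProperties L

  complementedPart : Carrier → Carrier
  complementedPart x = ⋁ {I = Σ Carrier λ b → IsComplemented b × b ≤ x} proj₁

  complemented-≤-complementedPart : ∀ {b x} → IsComplemented b → b ≤ x → b ≤ complementedPart x
  complemented-≤-complementedPart b-comp b≤x = ⋁-ub proj₁ (_ , b-comp , b≤x)

  complementedPart-≤ : ∀ x → complementedPart x ≤ x
  complementedPart-≤ x = ⋁-lub _ λ (_ , _ , b≤x) → b≤x

  complementedPart-mono : ∀ {x y} → x ≤ y → complementedPart x ≤ complementedPart y
  complementedPart-mono x≤y =
    ⋁-lub _ λ (_ , b-comp , b≤x) → complemented-≤-complementedPart b-comp (≤-trans b≤x x≤y)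

  complementedPart-∧ : ∀ x y → complementedPart x ∧ complementedPart y ≤ complementedPart (x ∧ y)
  complementedPart-∧ x y =
    ≤-trans (distribʳ _ _) (⋁-lub _ λ (_ , b₁-comp , b₁≤x) →
      ≤-trans (distrib _ _) (⋁-lub _ λ (_ , b₂-comp , b₂≤y) →
        complemented-≤-complementedPart (∧-complemented b₁-comp b₂-comp) (∧-mono b₁≤x b₂≤y)))

  IsJoinOfComplemented : Carrier → Set₁
  IsJoinOfComplemented x = x ≤ complementedPart x

  complemented⇒joinOfComplemented : ∀ {b} → IsComplemented b → IsJoinOfComplemented b
  complemented⇒joinOfComplemented b-comp = complemented-≤-complementedPart b-comp ≤-refl

  ∧-joinOfComplemented : ∀ {x y} → IsJoinOfComplemented x → IsJoinOfComplemented y →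
                         IsJoinOfComplemented (x ∧ y)
  ∧-joinOfComplemented x≤ y≤ = ≤-trans (∧-mono x≤ y≤) (complementedPart-∧ _ _)

  ⋁-joinOfComplemented : ∀ {I : Set₁} (f : I → Carrier) → (∀ i → IsJoinOfComplemented (f i)) →
                         IsJoinOfComplemented (⋁ f)
  ⋁-joinOfComplemented f f≤ = ⋁-lub _ λ i → ≤-trans (f≤ i) (complementedPart-mono (⋁-ub f i))

  ⋀-joinOfComplemented : ∀ n (f : Fin n → Carrier) → (∀ i → IsJoinOfComplemented (f i)) →
                         IsJoinOfComplemented (⋀ n f)
  ⋀-joinOfComplemented zero    f f≤ = complemented⇒joinOfComplemented top-complemented
  ⋀-joinOfComplemented (suc n) f f≤ =
    ∧-joinOfComplemented (f≤ zero) (⋀-joinOfComplemented n (f ∘ suc) (f≤ ∘ suc))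

module PresentationInduction (M : Monad) (lem : (P : Set) → Dec P) where
  open Monad M using (T)
  open Behaviour M lem

  -- The subframe is itself a model of the relations; the induced map into it,
  -- followed by the inclusion, agrees with the identity on generators.
  presentation-induction :
    ∀ {c ℓ q} {L : Frame c ℓ} {g : T Bool → Frame.Carrier L} → IsPresentation L g →
    {Q : Frame.Carrier L → Set q} → FrameProperties.IsSubframe L Q → (∀ b → Q (g b)) →
    ∀ x → Q x
  presentation-induction {c} {ℓ} {q} {L} {g} P {Q} Q-sub Q-gen =
    from-model (existence N gen gen-respects)
    where
    open Frame L
    open FrameProperties L
    open IsSubframe Q-sub
    open IsPresentation P

    N : Frame (c ⊔ q) ℓ
    N = subframe Q-sub

    gen : T Bool → Frame.Carrier N
    gen b = g b , Q-gen b

    gen-respects : Respects N gen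
    gen-respects =
        (λ t a a′ a≢a′ → ≤-trans (proj₁ (proj₁ respects t a a′ a≢a′)) (⋁-empty _ _) , ⋁-empty _ _)
      , proj₁ (proj₂ respects)
      , proj₂ (proj₂ respects)

    inclusion∘ : ∀ {f} → IsFrameHom L N f → IsFrameHom L L (proj₁ ∘ f)
    inclusion∘ f-hom = record
      { mono     = IsFrameHom.mono f-hom
      ; pres-∧   = IsFrameHom.pres-∧ f-hom
      ; pres-top = IsFrameHom.pres-top f-hom
      ; pres-⋁   = IsFrameHom.pres-⋁ f-hom
      }

    id-hom : IsFrameHom L L id
    id-hom = record
      { mono     = id
      ; pres-∧   = λ _ _ → ≤-refl , ≤-refl
      ; pres-top = ≤-refl , ≤-refl
      ; pres-⋁   = λ _ → ≤-refl , ≤-refl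
      }

    from-model : Σ (Carrier → Frame.Carrier N)
                   (λ f → IsFrameHom L N f × (∀ b → Frame._≈_ N (f (g b)) (gen b))) →
                 ∀ x → Q x
    from-model (f , f-hom , f-gen) x =
      ≈-closed (unique L (proj₁ ∘ f) id (inclusion∘ f-hom) id-hom f-gen x) (proj₂ (f x))

module TransitionProperties (M : Monad) (lem : (P : Set) → Dec P) (K : Set)
    (L : Frame (lsuc lzero) (lsuc lzero)) (g : Monad.T M Bool → Frame.Carrier L) where
  open Monad M
  open Behaviour M lem
  open Traces K L g
  open Frame L
  open FrameProperties L
  open ComplementedPart L
  open PresentationInduction M lem

  links : ∀ {n} → Vector (T ⊤) (suc n) → Fin n → Carrier
  links ms i = ⟦ ms (inject₁ i) ∼₁ ms (suc i) ⟧

  links-≤-⟦∼⟧ : ∀ n (ms : Vector (T ⊤) (suc n)) → ⋀ n (links ms) ≤ ⟦ ms zero ∼ ms (fromℕ n) ⟧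
  links-≤-⟦∼⟧ n ms = ⋁-ub _ (lift (n , ms , refl , refl))

  ⟦∼⟧-refl : ∀ m → top ≤ ⟦ m ∼ m ⟧
  ⟦∼⟧-refl m = links-≤-⟦∼⟧ 0 (m ∷ [])

  ⟦∼₁⟧-≤-⟦∼⟧ : ∀ m n → ⟦ m ∼₁ n ⟧ ≤ ⟦ m ∼ n ⟧
  ⟦∼₁⟧-≤-⟦∼⟧ m n = ≤-trans (∧-glb ≤-refl (top-max _)) (links-≤-⟦∼⟧ 1 (m ∷ n ∷ []))

  ⟦∼₁⟧-sym : ∀ m n → ⟦ m ∼₁ n ⟧ ≤ ⟦ n ∼₁ m ⟧
  ⟦∼₁⟧-sym m n = ⋁-lub _ λ (A , A≤κ , t , u , u′ , a , ua≡u′a , m≡ , n≡) →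
    ⋁-ub _ (A , A≤κ , t , u′ , u , a , sym ua≡u′a , n≡ , m≡)

  ⟦∼₁⟧-∼-trans : ∀ x y z → ⟦ x ∼₁ y ⟧ ∧ ⟦ y ∼ z ⟧ ≤ ⟦ x ∼ z ⟧
  ⟦∼₁⟧-∼-trans x y z = ≤-trans (distrib _ _)
    (⋁-lub _ λ { (lift (n , ms , refl , refl)) → links-≤-⟦∼⟧ (suc n) (x ∷ ms) })

  ⟦∼⟧-trans : ∀ x y z → ⟦ x ∼ y ⟧ ∧ ⟦ y ∼ z ⟧ ≤ ⟦ x ∼ z ⟧
  ⟦∼⟧-trans x y z =
    ≤-trans (distribʳ _ _) (⋁-lub _ λ { (lift (n , ms , refl , refl)) → chain-trans n ms })
    where
    chain-trans : ∀ n (ms : Vector (T ⊤) (suc n)) →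
                  ⋀ n (links ms) ∧ ⟦ ms (fromℕ n) ∼ z ⟧ ≤ ⟦ ms zero ∼ z ⟧
    chain-trans zero    ms = ∧-lb₂ _ _
    chain-trans (suc n) ms = ≤-trans (∧-assoc _ _ _)
      (≤-trans (∧-mono ≤-refl (chain-trans n (ms ∘ suc))) (⟦∼₁⟧-∼-trans _ _ _))

  ⟦∼⟧-sym : ∀ x y → ⟦ x ∼ y ⟧ ≤ ⟦ y ∼ x ⟧
  ⟦∼⟧-sym x y = ⋁-lub _ λ { (lift (n , ms , refl , refl)) → chain-sym n ms }
    where
    chain-sym : ∀ n (ms : Vector (T ⊤) (suc n)) → ⋀ n (links ms) ≤ ⟦ ms (fromℕ n) ∼ ms zero ⟧
    chain-sym zero    ms = ⟦∼⟧-refl _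
    chain-sym (suc n) ms = ≤-trans (∧-comm _ _)
      (≤-trans (∧-mono (chain-sym n (ms ∘ suc)) (≤-trans (⟦∼₁⟧-sym _ _) (⟦∼₁⟧-≤-⟦∼⟧ _ _)))
               (⟦∼⟧-trans _ _ _))

  hat-refl : ∀ n → top ≤ hat n n
  hat-refl n = complemented-≤-complementedPart top-complemented (⟦∼⟧-refl n)

  hat-trans : ∀ {m n₁ n₂ b} → IsComplemented b → n₁ ∼[ b ] n₂ → hat m n₁ ∧ b ≤ hat m n₂
  hat-trans b-comp b≤ =
    ≤-trans (∧-mono ≤-refl (complemented-≤-complementedPart b-comp b≤))
      (≤-trans (complementedPart-∧ _ _) (complementedPart-mono (⟦∼⟧-trans _ _ _)))

  IsLB1-intro : ∀ w → (∀ m₁ m₂ b → IsComplemented b → m₁ ∼[ b ] m₂ → b ∧ w m₁ ≤ w m₂) → IsLB1 w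
  IsLB1-intro w transport m₁ m₂ b b-comp b≤ =
    one-way m₁ m₂ b≤ , one-way m₂ m₁ (≤-trans b≤ (⟦∼⟧-sym m₁ m₂))
    where
    one-way : ∀ n₁ n₂ → n₁ ∼[ b ] n₂ → b ∧ w n₁ ≤ b ∧ w n₂
    one-way n₁ n₂ b≤ = ∧-glb (∧-lb₁ _ _) (transport n₁ n₂ b b-comp b≤)

  hat∧const-IsLB1 : ∀ m u → IsLB1 (hat m ∧̇ const u)
  hat∧const-IsLB1 m u = IsLB1-intro _ λ n₁ n₂ b b-comp b≤ →
    ∧-glb (≤-trans (∧-glb (≤-trans (∧-lb₂ _ _) (∧-lb₁ _ _)) (∧-lb₁ _ _)) (hat-trans b-comp b≤))
          (≤-trans (∧-lb₂ _ _) (∧-lb₂ _ _))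

  hat∧const-≤ : ∀ {w} → IsLB1 w → ∀ m → (hat m ∧̇ const (w m)) ≤̇ w
  hat∧const-≤ w-LB1 m n = ≤-trans (distribʳ _ _) (⋁-lub _ λ (b , b-comp , b≤) →
    ≤-trans (proj₁ (w-LB1 m n b b-comp b≤)) (∧-lb₂ _ _))

  ≤-hat∧const : ∀ (w : T ⊤ → Carrier) n → w n ≤ (hat n ∧̇ const (w n)) n
  ≤-hat∧const w n = ∧-glb (≤-trans (top-max (w n)) (hat-refl n)) ≤-refl

  hatPieces : (T ⊤ → Carrier) → Lift (lsuc lzero) (T ⊤) → T ⊤ → Carrier
  hatPieces w (lift m) = hat m ∧̇ const (w m)

  IsLB1-decomposition : ∀ {w} → IsLB1 w → w ≈̇ ⋁̇ (hatPieces w)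
  IsLB1-decomposition {w} w-LB1 n =
      ≤-trans (≤-hat∧const w n) (⋁-ub pieces (lift n))
    , ⋁-lub pieces λ (lift m) → hat∧const-≤ w-LB1 m n
    where
    pieces : Lift (lsuc lzero) (T ⊤) → Carrier
    pieces i = hatPieces w i n

  ↦-cover : Respects L g → ∀ {A} (t : T A) →
            top ≤ ⋁ {I = Lift (lsuc lzero) A} (λ a → g (t ↦ lower a))
  ↦-cover (_ , return-↦ , bind-↦) t = ≤-trans (proj₂ (return-↦ t tt))
    (≤-trans (proj₁ (bind-↦ t (λ _ → return tt) tt)) (⋁-mono λ _ → ∧-lb₁ _ _))

  ↦-complemented : Respects L g → ∀ {A} (t : T A) a → IsComplemented (g (t ↦ a))
  ↦-complemented respects@(↦-disjoint , _) {A} t a = complemented others disjoint cover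
    where
    others : Carrier
    others = ⋁ {I = Lift (lsuc lzero) (Σ A (a ≢_))} (λ i → g (t ↦ proj₁ (lower i)))
    disjoint : g (t ↦ a) ∧ others ≤ bot
    disjoint = ≤-trans (distrib _ _)
      (⋁-lub _ λ (lift (a′ , a≢a′)) → proj₁ (↦-disjoint t a a′ a≢a′))
    covered : ∀ a′ → g (t ↦ a′) ≤ g (t ↦ a) ∨ others
    covered a′ with lem (a ≡ a′)
    ... | yes refl = x≤x∨y _ _
    ... | no a≢a′  = ≤-trans (⋁-ub (λ i → g (t ↦ proj₁ (lower i))) (lift (a′ , a≢a′))) (y≤x∨y _ _)
    cover : top ≤ g (t ↦ a) ∨ others
    cover = ≤-trans (↦-cover respects t) (⋁-lub _ λ (lift a′) → covered a′)

  ⟦∼⟧-joinOfComplemented : Respects L g → ∀ m n → IsJoinOfComplemented ⟦ m ∼ n ⟧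
  ⟦∼⟧-joinOfComplemented respects m n =
    ⋁-joinOfComplemented _ λ (lift (k , ms , _)) → ⋀-joinOfComplemented k _ λ i →
      ⋁-joinOfComplemented _ λ (_ , _ , t , _ , _ , a , _) →
        complemented⇒joinOfComplemented (↦-complemented respects t a)

  hat≈⟦∼⟧ : Respects L g → ∀ m n → hat m n ≈ ⟦ m ∼ n ⟧
  hat≈⟦∼⟧ respects m n = complementedPart-≤ _ , ⟦∼⟧-joinOfComplemented respects m n

  module _ (P : IsPresentation L g) where
    open IsPresentation P using (respects)

    hat∧const-generated : ∀ S → IsSubframeContainingGens S → ∀ m u → S (hat m ∧̇ const u)
    hat∧const-generated S (S-≈ , S-gen , _ , S-∧ , S-⋁) m =
      presentation-induction P Q-sub Q-gen
      where
      Q : Carrier → Set₂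
      Q u = S (hat m ∧̇ const u)
      Q-≈ : ∀ {x y} → x ≈ y → Q x → Q y
      Q-≈ x≈y = S-≈ _ _ λ _ → ∧-congˡ x≈y
      Q-gen : ∀ b → Q (g b)
      Q-gen b = S-≈ _ _ (λ n → ∧-congʳ (≈-sym (hat≈⟦∼⟧ respects m n))) (S-gen m b)
      top-is-generator : g ((return tt >> return tt) ↦ tt) ≈ top
      top-is-generator = proj₁ (proj₂ respects) (return tt) tt
      Q-sub : IsSubframe Q
      Q-sub = record
        { ≈-closed   = Q-≈
        ; top-closed = Q-≈ top-is-generator (Q-gen _)
        ; ∧-closed   = λ Qx Qy → S-≈ _ _ (λ _ → ≈-sym (∧-distribˡ-∧ _ _ _)) (S-∧ _ _ Qx Qy)
        ; ⋁-closed   = λ f Qf → S-≈ _ _ (λ _ → ≈-sym (∧-distribˡ-⋁ _ f)) (S-⋁ _ _ Qf)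
        }

    IsLB1-generated : ∀ S → IsSubframeContainingGens S → ∀ w → IsLB1 w → S w
    IsLB1-generated S S-sub@(S-≈ , _ , _ , _ , S-⋁) w w-LB1 =
      S-≈ _ _ (λ n → ≈-sym (IsLB1-decomposition w-LB1 n))
        (S-⋁ _ (hatPieces w) λ (lift m) → hat∧const-generated S S-sub m (w m))

lemma3p12 : (M : Monad) (K : Set) → IsRanked M K → (lem : (P : Set) → Dec P) →
  let open Monad M in
  (L : Frame (Level.suc Level.zero) (Level.suc Level.zero)) (g : T Bool → Frame.Carrier L) →
  Behaviour.IsPresentation M lem L g →
  let open Frame L
      open Behaviour.Traces M lem K L g
  in
  -- every w ∈ 𝒪(LB₁T) is the join in 𝒪(LB₁T) of the opens m̂ ∧ const_{w(m)}
  (∀ (w : T ⊤ → Carrier) → IsLB1 w →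
      (∀ m → IsLB1 (hat m ∧̇ const (w m)))
    × (∀ m → (hat m ∧̇ const (w m)) ≤̇ w)
    × (∀ v → IsLB1 v → (∀ m → (hat m ∧̇ const (w m)) ≤̇ v) → w ≤̇ v))
  ×
  -- 𝒪(LB₁T) is generated (as a frame) by the opens [m | b]
  (∀ (S : (T ⊤ → Carrier) → Set₂) → IsSubframeContainingGens S →
     ∀ (w : T ⊤ → Carrier) → IsLB1 w → S w)
lemma3p12 M K _ lem L g P =
    (λ w w-LB1 → (λ m → hat∧const-IsLB1 m (w m))
               , hat∧const-≤ w-LB1
               , λ v _ w-pieces≤v n → ≤-trans (≤-hat∧const w n) (w-pieces≤v n n))
  , IsLB1-generated P
  where
  open Frame L using (≤-trans)
  open TransitionProperties M lem K L g
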